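{- Let $n \geq 2$ be an integer and $p > \sqrt{n}$ a prime. Then $s_p(n) \geq p$ if and only if $\Delta_n(p) = 1$.
   Context: $s_p(n)$ denotes the sum of the digits of $n$ in base $p$. For an integer $n \geq 2$ and real $x > \sqrt{n}$ define $\phi_n(x) := \lfloor \frac{n-1}{x-1} \rfloor$, $\psi_n(x) := \lfloor \frac{n}{x} \rfloor$, and $\Delta_n(x) := \phi_n(x) - \psi_n(x)$, where $\lfloor \cdot \rfloor$ is the integer part. -}

module Defs where

open import Data.Nat using (ℕ; zero; suc; _+_; _*_; _∸_; NonZero)
open import Data.Nat.DivMod using (_/_; _%_)
open import Data.Integer using (ℤ; +_; _-_)

digitSumAux : (b : ℕ) .{{_ : NonZero b}} → ℕ → ℕ → ℕ
digitSumAux b zero    m = 0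
digitSumAux b (suc k) zero = 0
digitSumAux b (suc k) m@(suc _) = m % b + digitSumAux b k (m / b)

-- s_b(m): the sum of the digits of m in base b.  For b ≥ 2 the fuel m is
-- sufficient, since m has at most m base-b digits.
s : (b : ℕ) .{{_ : NonZero b}} → ℕ → ℕ
s b m = digitSumAux b m m

φ : (n x : ℕ) .{{_ : NonZero (x ∸ 1)}} → ℕ
φ n x = (n ∸ 1) / (x ∸ 1)

ψ : (n x : ℕ) .{{_ : NonZero x}} → ℕ
ψ n x = n / x

Δ : (n x : ℕ) .{{_ : NonZero (x ∸ 1)}} .{{_ : NonZero x}} → ℤ
Δ n x = + φ n x - + ψ n x

module Submission where

-- Let p = d + 1 ≥ 2 and n < p², and write n = a·p + b with digits
-- a = ⌊n/p⌋ < p and b = n mod p < p.  Then: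
--   * n has at most two base-p digits, so s_p(n) = a + b;
--   * writing a + b = r + 1 (possible as n ≥ 1), we get n - 1 = a·d + r,
--     hence φ_n(p) = a + ⌊r/d⌋ and ψ_n(p) = a, so Δ_n(p) = ⌊r/d⌋;
--   * since a, b ≤ d we have r < 2d, so ⌊r/d⌋ = 1 exactly when d ≤ r,
--     i.e. when s_p(n) = r + 1 ≥ p.
-- The file proves these facts in this order: digit sums of two-digit
-- numbers, the formula for Δ in terms of the digits, the quotient
-- criterion, and finally the theorem.

open import Defs
open import Data.Nat using (ℕ; zero; suc; _+_; _*_; _∸_; _≤_; _<_; _≥_; z≤n; s≤s; s≤s⁻¹; NonZero)
open import Data.Nat.Properties
  using (+-identityʳ; n≮0; 1+n≢0; ≤-reflexive; ≤-trans; +-assoc; +-comm; +-suc; *-suc; m+n≡0⇒m≡0; m+n≡0⇒n≡0; m≤m+n; m+n∸m≡n; m<n+o⇒m∸n<o; +-mono-≤)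
open import Data.Nat.DivMod
  using (_/_; _%_; m≡m%n+[m/n]*n; m%n<n; m<n⇒m%n≡m; m<n⇒m/n≡0; m*n/n≡m; +-distrib-/-∣ˡ; m<n*o⇒m/o<n; m/n≢0⇒n≤m; m/n≡1+[m∸n]/n)
open import Data.Nat.Divisibility using (divides)
open import Data.Nat.Primality using (Prime)
open import Data.Integer using (+_; _-_)
open import Data.Integer.Properties using ([+m]-[+n]≡m⊖n; ⊖-≥; +-injective)
open import Data.Empty using (⊥-elim)
open import Data.Product using (_×_; _,_; Σ-syntax)
open import Relation.Binary.PropositionalEquality using (_≡_; refl; sym; trans; cong; cong₂; subst; module ≡-Reasoning)

digitSum-zero : ∀ b .{{_ : NonZero b}} k → digitSumAux b k 0 ≡ 0
digitSum-zero b zero    = refl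
digitSum-zero b (suc k) = refl

digitSum-digit : ∀ b .{{_ : NonZero b}} k a → a < b → digitSumAux b (suc k) a ≡ a
digitSum-digit b k zero    a<b = refl
digitSum-digit b k (suc a) a<b
  rewrite m<n⇒m%n≡m a<b | m<n⇒m/n≡0 a<b | digitSum-zero b k = +-identityʳ (suc a)

digitSum-twoDigits : ∀ b .{{_ : NonZero b}} m → m ≥ 2 → m / b < b → s b m ≡ m % b + m / b
digitSum-twoDigits b (suc zero) (s≤s ()) _
digitSum-twoDigits b m@(suc (suc k)) _ m/b<b =
  cong (_+_ (m % b)) (digitSum-digit b k (m / b) m/b<b)

digits-positive : ∀ b .{{_ : NonZero b}} m → m ≥ 1 → Σ[ r ∈ ℕ ] m % b + m / b ≡ suc r
digits-positive b m m≥1 with m % b + m / b in digits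
... | suc r = r , refl
... | zero  = ⊥-elim (n≮0 (subst (1 ≤_) m≡0 m≥1))
  where
  m≡0 : m ≡ 0
  m≡0 = begin
    m                      ≡⟨ m≡m%n+[m/n]*n m b ⟩
    m % b + (m / b) * b    ≡⟨ cong₂ (λ x y → x + y * b) (m+n≡0⇒m≡0 (m % b) digits) (m+n≡0⇒n≡0 (m % b) digits) ⟩
    0                      ∎
    where open ≡-Reasoning

+[m+n]-+m≡+n : ∀ m n → + (m + n) - + m ≡ + n
+[m+n]-+m≡+n m n = trans ([+m]-[+n]≡m⊖n (m + n) m) (trans (⊖-≥ (m≤m+n m n)) (cong +_ (m+n∸m≡n m n)))

-- Δ in terms of the digits: if n mod (d+1) + ⌊n/(d+1)⌋ = r + 1 then Δ_n(d+1) = ⌊r/d⌋.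
-- Indeed n = a·(d+1) + b = a·d + (r + 1), so φ_n(d+1) = ⌊(a·d + r)/d⌋ = a + ⌊r/d⌋.
Δ-digits : ∀ n d .{{_ : NonZero d}} r → n % suc d + n / suc d ≡ suc r → Δ n (suc d) ≡ + (r / d)
Δ-digits n d r digits = begin
  + φ n (suc d) - + a   ≡⟨ cong (λ x → + x - + a) φ≡ ⟩
  + (a + r / d) - + a   ≡⟨ +[m+n]-+m≡+n a (r / d) ⟩
  + (r / d)             ∎
  where
  open ≡-Reasoning
  a = n / suc d
  b = n % suc d
  n≡ : n ≡ suc (a * d + r)
  n≡ = begin
    n                   ≡⟨ m≡m%n+[m/n]*n n (suc d) ⟩
    b + a * suc d       ≡⟨ cong (_+_ b) (*-suc a d) ⟩
    b + (a + a * d)     ≡⟨ sym (+-assoc b a (a * d)) ⟩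
    (b + a) + a * d     ≡⟨ +-comm (b + a) (a * d) ⟩
    a * d + (b + a)     ≡⟨ cong (_+_ (a * d)) digits ⟩
    a * d + suc r       ≡⟨ +-suc (a * d) r ⟩
    suc (a * d + r)     ∎
  φ≡ : φ n (suc d) ≡ a + r / d
  φ≡ = begin
    (n ∸ 1) / d         ≡⟨ cong (λ x → (x ∸ 1) / d) n≡ ⟩
    (a * d + r) / d     ≡⟨ +-distrib-/-∣ˡ r (divides a refl) ⟩
    a * d / d + r / d   ≡⟨ cong (_+ (r / d)) (m*n/n≡m a d) ⟩
    a + r / d           ∎

quotient≡1⇒≥ : ∀ r d .{{_ : NonZero d}} → r / d ≡ 1 → d ≤ r
quotient≡1⇒≥ r d r/d≡1 = m/n≢0⇒n≤m (λ r/d≡0 → 1+n≢0 (trans (sym r/d≡1) r/d≡0))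

≥⇒quotient≡1 : ∀ r d .{{_ : NonZero d}} → r < d + d → d ≤ r → r / d ≡ 1
≥⇒quotient≡1 r d r<2d d≤r = begin
  r / d             ≡⟨ m/n≡1+[m∸n]/n d≤r ⟩
  1 + (r ∸ d) / d   ≡⟨ cong (_+_ 1) (m<n⇒m/n≡0 (m<n+o⇒m∸n<o r d r<2d)) ⟩
  1                 ∎
  where open ≡-Reasoning

lemma6 : (n q : ℕ) → n ≥ 2 → Prime (suc (suc q)) → n < suc (suc q) * suc (suc q) →
    (s (suc (suc q)) n ≥ suc (suc q) → Δ n (suc (suc q)) ≡ + 1) ×
    (Δ n (suc (suc q)) ≡ + 1 → s (suc (suc q)) n ≥ suc (suc q))
lemma6 n q n≥2 _ n<p² with digits-positive (suc (suc q)) n (≤-trans (s≤s z≤n) n≥2)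
... | r , digits≡ = sum≥p⇒Δ≡1 , Δ≡1⇒sum≥p
  where
  d = suc q
  p = suc d
  a≤d : n / p ≤ d
  a≤d = s≤s⁻¹ (m<n*o⇒m/o<n n<p²)
  b≤d : n % p ≤ d
  b≤d = s≤s⁻¹ (m%n<n n p)
  sum≡ : s p n ≡ suc r
  sum≡ = trans (digitSum-twoDigits p n n≥2 (s≤s a≤d)) digits≡
  Δ≡ : Δ n p ≡ + (r / d)
  Δ≡ = Δ-digits n d r digits≡
  r<2d : r < d + d
  r<2d = ≤-trans (≤-reflexive (sym digits≡)) (+-mono-≤ b≤d a≤d)
  sum≥p⇒Δ≡1 : s p n ≥ p → Δ n p ≡ + 1
  sum≥p⇒Δ≡1 sum≥p = trans Δ≡ (cong +_ (≥⇒quotient≡1 r d r<2d (s≤s⁻¹ (subst (p ≤_) sum≡ sum≥p))))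
  Δ≡1⇒sum≥p : Δ n p ≡ + 1 → s p n ≥ p
  Δ≡1⇒sum≥p Δ≡1 = subst (p ≤_) (sym sum≡) (s≤s (quotient≡1⇒≥ r d (+-injective (trans (sym Δ≡) Δ≡1))))
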